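{- $b_{\mathrm{LNBF}_\delta} \in \mathcal{N}_{\mathrm{LNBF}_\delta}$ for all $\delta \in \mathbb{N}$. In particular, $b_{\mathrm{BF}} \in \mathcal{N}_{\mathrm{BF}}$.
   Context: $\mathcal{N}_{\mathbf{M}}$ is the set of Nečiporuk functions for a complexity measure $\mathbf{M}$: non-decreasing $b\colon \mathbb{N}_{>0}\to\mathbb{N}$ such that for every $n$, every $n$-ary Boolean $f$ and every partition $V_1,\dots,V_p$ of $[n]$, $\mathbf{M}(f) \ge \sum_{i=1}^p b(r_{V_i}(f))$, where $r_V(f)$ is the number of distinct subfunctions of $f$ on $V$ obtained by fixing the variables outside $V$. A Boolean binary formula is a binary tree whose internal nodes are labelled by arbitrary functions $\{0,1\}^2\to\{0,1\}$ and whose leaves are labelled by constants or literals; its size is the number of non-constant leaves; $\mathrm{BF}(f)$ is the minimum size of a formula computing $f$. $\mathrm{LNBF}_\delta(f)$ is the minimum size of a formula $\varphi'$ on $n+\delta$ variables with $f(a) = \bigvee_{b\in\{0,1\}^\delta}f_{\varphi'}(a,b)$. Define $b_{\mathrm{LNBF}_\delta}(m) = \bigl\lceil \frac14 \max\bigl\{\frac{\log_2 m}{2^\delta}, \log_2\log_2 m\bigr\}\bigr\rceil$ if $m \ge 4$ and $0$ otherwise, and $b_{\mathrm{BF}} = b_{\mathrm{LNBF}_0}$. -}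

module Defs where

open import Data.Bool using (Bool; true; false; if_then_else_; _∨_)
open import Data.Bool.Properties using () renaming (_≟_ to _≟B_)
open import Data.Nat using (ℕ; zero; suc; _+_; _*_; _^_; _≤_; _<?_; _⊔_; _/_; _∸_)
open import Data.Nat.Logarithm using (⌈log₂_⌉)
open import Data.Fin using (Fin)
open import Data.Vec using (Vec; []; _∷_; lookup; tabulate; _++_)
open import Data.List using (List; []; _∷_; map; concatMap; length; allFin; deduplicate)
open import Data.Bool.ListAction using (or; all)
open import Data.Nat.ListAction using (sum)
open import Data.Product using (_×_)
open import Relation.Nullary using (yes; no; Dec)
open import Relation.Nullary.Decidable using (⌊_⌋)
open import Relation.Binary.PropositionalEquality using (_≡_)

BoolFun : ℕ → Set
BoolFun n = Vec Bool n → Bool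

allVecs : (n : ℕ) → List (Vec Bool n)
allVecs zero    = [] ∷ []
allVecs (suc n) = concatMap (λ v → (false ∷ v) ∷ (true ∷ v) ∷ []) (allVecs n)

Subset : ℕ → Set
Subset n = Fin n → Bool

merge : ∀ {n} → Subset n → Vec Bool n → Vec Bool n → Vec Bool n
merge V a c = tabulate (λ i → if V i then lookup a i else lookup c i)

-- the subfunction of f on V obtained by fixing the variables outside V
-- according to c (only the coordinates of a in V are relevant)
subfun : ∀ {n} → BoolFun n → Subset n → Vec Bool n → (Vec Bool n → Bool)
subfun f V c a = f (merge V a c)

sameSub : ∀ {n} → BoolFun n → Subset n → Vec Bool n → Vec Bool n → Bool
sameSub {n} f V c c' =
  all (λ a → ⌊ subfun f V c a ≟B subfun f V c' a ⌋) (allVecs n)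

r : ∀ {n} → BoolFun n → Subset n → ℕ
r {n} f V = length (deduplicate (λ c c' → sameSub f V c c' ≟B true) (allVecs n))

-- Nečiporuk functions for a complexity measure.
-- A complexity measure M is represented by the relation  M≥ f k  meaning
-- M(f) ≥ k.

Measure≥ : Set₁
Measure≥ = ∀ {n} → BoolFun n → ℕ → Set

NonDecreasing : (ℕ → ℕ) → Set
NonDecreasing b = ∀ m m' → 1 ≤ m → m ≤ m' → b m ≤ b m'

-- a partition V_1,…,V_p of [n] is given by the block map Fin n → Fin p
block : ∀ {n p} → (Fin n → Fin p) → Fin p → Subset n
block {p = p} π i j = ⌊ Data.Fin._≟_ (π j) i ⌋

IsNeciporuk : Measure≥ → (ℕ → ℕ) → Set
IsNeciporuk M≥ b =
  NonDecreasing b ×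
  (∀ n (f : BoolFun n) p (π : Fin n → Fin p) →
     M≥ f (sum (map (λ i → b (r f (block π i))) (allFin p))))

data Formula (n : ℕ) : Set where
  const : Bool → Formula n
  lit   : Bool → Fin n → Formula n
  node  : (Bool → Bool → Bool) → Formula n → Formula n → Formula n

eval : ∀ {n} → Formula n → Vec Bool n → Bool
eval (const c)    x = c
eval (lit true i)  x = lookup x i
eval (lit false i) x = Data.Bool.not (lookup x i)
eval (node g φ ψ) x = g (eval φ x) (eval ψ x)

size : ∀ {n} → Formula n → ℕ
size (const _)    = 0
size (lit _ _)    = 1
size (node _ φ ψ) = size φ + size ψ

-- BF(f) ≥ k : every formula computing f has size ≥ k
-- (equivalently the minimum size, which exists, is ≥ k)
BF≥ : Measure≥
BF≥ {n} f k = (φ : Formula n) → (∀ a → f a ≡ eval φ a) → k ≤ size φ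

NDComputes : ∀ {n} δ → Formula (n + δ) → BoolFun n → Set
NDComputes {n} δ φ f = ∀ a → f a ≡ or (map (λ b → eval φ (a ++ b)) (allVecs δ))

LNBF≥ : ℕ → Measure≥
LNBF≥ δ {n} f k = (φ : Formula (n + δ)) → NDComputes δ φ f → k ≤ size φ

-- b_{LNBF_δ}(m) = ⌈ (1/4) max{ log₂ m / 2^δ , log₂ log₂ m } ⌉  (m ≥ 4), else 0.
-- For m ≥ 4 and natural k:
--   log₂ m / (4·2^δ) ≤ k  ⇔  ⌈log₂ m⌉ ≤ 4·2^δ·k, so ⌈log₂ m /(4·2^δ)⌉ = ⌈⌈log₂ m⌉ /(4·2^δ)⌉;
--   log₂ log₂ m ≤ 4k ⇔ m ≤ 2^(2^(4k)) ⇔ ⌈log₂ ⌈log₂ m⌉⌉ ≤ 4k,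
--   so ⌈log₂ log₂ m / 4⌉ = ⌈⌈log₂ ⌈log₂ m⌉⌉ / 4⌉;
-- and ⌈max(x,y)⌉ = max(⌈x⌉,⌈y⌉).

ceilDiv : ℕ → (d : ℕ) → ℕ
ceilDiv x zero    = 0
ceilDiv x (suc d) = (x + d) / suc d

b-LNBF : ℕ → ℕ → ℕ
b-LNBF δ m with m Data.Nat.<? 4
... | yes _ = 0
... | no  _ = ceilDiv ⌈log₂ m ⌉ (4 * 2 ^ δ) ⊔ ceilDiv ⌈log₂ ⌈log₂ m ⌉ ⌉ 4

b-BF : ℕ → ℕ
b-BF = b-LNBF 0

-- Fix a block V of the partition and a formula φ on n + δ variables computing f nondeterministically.
-- Fixing the δ guessed bits turns φ into 2^δ formulas ψ_b on the original variables, all with the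
-- same leaves as φ; let s be the number of those leaves labelled by variables of V. A subfunction
-- of f on V is the disjunction over b of the restrictions of the ψ_b, so it depends only on the s
-- leaf variables, whence r_V(f) ≤ 2^(2^s). If s ≥ 1, Nečiporuk's counting shows that a restriction
-- of a single formula is one of at most 16^s functions, whence r_V(f) ≤ (16^s)^(2^δ). Together the
-- two bounds give b_LNBF_δ(r_V(f)) ≤ s, and the numbers s summed over the blocks are at most the
-- size of φ. For BF take δ = 0, with φ itself as the only disjunct.

module Submission where

open import Defs
open import Data.Bool using (Bool; true; false; if_then_else_; _∨_; not; T)
open import Data.Bool.Properties using (T-≡; ∨-identityʳ) renaming (_≟_ to _≟B_)
open import Data.Bool.ListAction using (or)
open import Data.Empty using (⊥-elim)
open import Data.Fin using (Fin; zero; suc; splitAt) renaming (_<_ to _<ᶠ_; _≟_ to _≟ᶠ_)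
open import Data.Fin.Properties using (injective⇒≤) renaming (<-cmp to <ᶠ-cmp)
open import Data.List using (List; []; _∷_; map; length; _++_; deduplicate; allFin; cartesianProductWith; concatMap)
import Data.List as List
open import Data.List.Properties using (length-++; length-map; map-cong; map-tabulate; map-∘)
open import Data.List.Membership.Propositional using (_∈_)
open import Data.List.Membership.Propositional.Properties using (∈-lookup; ∈-++⁺ˡ; ∈-++⁺ʳ)
open import Data.List.Relation.Unary.All using (All; []; _∷_)
import Data.List.Relation.Unary.All as All
open import Data.List.Relation.Unary.All.Properties using (all-filter; all⁻)
open import Data.List.Relation.Unary.AllPairs using (AllPairs; []; _∷_)
import Data.List.Relation.Unary.AllPairs.Properties as AllPairs
open import Data.List.Relation.Unary.Any using (Any; here; there; index)
import Data.List.Relation.Unary.Any as Any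
open import Data.List.Relation.Unary.Any.Properties using (lookup-index; cartesianProductWith⁺)
open import Data.Nat using (ℕ; zero; suc; _+_; _*_; _^_; _≤_; z≤n; s≤s; _<?_)
open import Data.Nat.ListAction using (sum)
open import Data.Nat.Logarithm using (⌈log₂_⌉; ⌈log₂⌉-mono-≤; ⌈log₂2^n⌉≡n)
open import Data.Nat.DivMod using (m<n*o⇒m/o<n; /-monoˡ-≤)
open import Data.Nat.Properties
open import Data.Nat.Tactic.RingSolver using (solve-∀)
open import Data.Product using (Σ; ∃-syntax; _,_; _×_)
open import Data.Sum using (inj₁; inj₂; [_,_]′)
open import Data.Unit using (tt)
import Data.Vec as Vec
open import Data.Vec using (Vec; lookup; replicate; _[_]≔_) renaming (_++_ to _++ᵛ_)
open import Data.Vec.Properties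
  using (lookup∘tabulate; lookup-splitAt; []≔-lookup; lookup∘update; lookup∘update′)
open import Function using (_∘_; _∘′_; id; Equivalence)
open import Relation.Binary using (tri<; tri≈; tri>)
open import Relation.Binary.PropositionalEquality
open import Relation.Nullary using (Dec; yes; no; ¬_; ¬?)
open import Relation.Nullary.Decidable using (⌊_⌋; fromWitness)

private
  variable
    A B C : Set
    m n : ℕ

length-cartesianProductWith : ∀ (g : A → B → C) xs ys →
  length (cartesianProductWith g xs ys) ≡ length xs * length ys
length-cartesianProductWith g []       ys = refl
length-cartesianProductWith g (x ∷ xs) ys = begin
  length (map (g x) ys ++ cartesianProductWith g xs ys)
    ≡⟨ length-++ (map (g x) ys) ⟩
  length (map (g x) ys) + length (cartesianProductWith g xs ys)
    ≡⟨ cong₂ _+_ (length-map (g x) ys) (length-cartesianProductWith g xs ys) ⟩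
  length ys + length xs * length ys ∎
  where open ≡-Reasoning

AllPairs-lookup : ∀ {R : A → A → Set} {xs} → AllPairs R xs →
  ∀ {i j : Fin (length xs)} → i <ᶠ j → R (List.lookup xs i) (List.lookup xs j)
AllPairs-lookup (Rx ∷ _)   {zero}  {suc j} _         = All.lookup Rx (∈-lookup j)
AllPairs-lookup (_  ∷ Rxs) {suc i} {suc j} (s≤s i<j) = AllPairs-lookup Rxs i<j

AllPairs¬⇒length≤ : ∀ {R : A → A → Set} {xs k} → AllPairs (λ x y → ¬ R x y) xs →
  (h : A → Fin k) → (∀ {x y} → h x ≡ h y → R x y) → length xs ≤ k
AllPairs¬⇒length≤ {xs = xs} separated h collide =
  injective⇒≤ {f = h ∘ List.lookup xs} injective
  where
  injective : ∀ {i j} → h (List.lookup xs i) ≡ h (List.lookup xs j) → i ≡ j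
  injective {i} {j} eq with <ᶠ-cmp i j
  ... | tri< i<j _ _ = ⊥-elim (AllPairs-lookup separated i<j (collide eq))
  ... | tri≈ _ i≡j _ = i≡j
  ... | tri> _ _ j<i = ⊥-elim (AllPairs-lookup separated j<i (collide (sym eq)))

deduplicate-AllPairs : ∀ {R : A → A → Set} (R? : ∀ x y → Dec (R x y)) xs →
  AllPairs (λ x y → ¬ R x y) (deduplicate R? xs)
deduplicate-AllPairs R? []       = []
deduplicate-AllPairs R? (x ∷ xs) =
  all-filter (¬? ∘ R? x) (deduplicate R? xs) ∷ AllPairs.filter⁺ _ (deduplicate-AllPairs R? xs)

length-concatMap-pair : ∀ (g h : A → B) xs → length (concatMap (λ x → g x ∷ h x ∷ []) xs) ≡ 2 * length xs
length-concatMap-pair g h []       = refl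
length-concatMap-pair g h (x ∷ xs) =
  trans (cong (2 +_) (length-concatMap-pair g h xs)) (sym (*-suc 2 (length xs)))

length-allVecs : ∀ n → length (allVecs n) ≡ 2 ^ n
length-allVecs zero    = refl
length-allVecs (suc n) =
  trans (length-concatMap-pair (false Vec.∷_) (true Vec.∷_) (allVecs n)) (cong (2 *_) (length-allVecs n))

sum-map-+ : ∀ (g h : A → ℕ) xs → sum (map (λ x → g x + h x) xs) ≡ sum (map g xs) + sum (map h xs)
sum-map-+ g h []       = refl
sum-map-+ g h (x ∷ xs) = begin
  g x + h x + sum (map (λ x → g x + h x) xs)   ≡⟨ cong (g x + h x +_) (sum-map-+ g h xs) ⟩
  g x + h x + (sum (map g xs) + sum (map h xs)) ≡⟨ interchange (g x) (h x) _ _ ⟩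
  g x + sum (map g xs) + (h x + sum (map h xs)) ∎
  where
  open ≡-Reasoning
  interchange : ∀ a b c d → a + b + (c + d) ≡ a + c + (b + d)
  interchange = solve-∀

sum-map-mono : ∀ {g h : A → ℕ} → (∀ x → g x ≤ h x) → ∀ xs → sum (map g xs) ≤ sum (map h xs)
sum-map-mono g≤h []       = z≤n
sum-map-mono g≤h (x ∷ xs) = +-mono-≤ (g≤h x) (sum-map-mono g≤h xs)

Covers : BoolFun n → Subset n → List (BoolFun n) → Set
Covers f V W = ∀ c → Any (subfun f V c ≗_) W

-- r f V is the length of a list of fixings with pairwise distinct subfunctions, and sending each
-- fixing to the position of its subfunction in W is injective on that list.
r≤length : ∀ (f : BoolFun n) V {W} → Covers f V W → r f V ≤ length W
r≤length {n} f V {W} cover =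
  AllPairs¬⇒length≤ (deduplicate-AllPairs _ (allVecs n)) (index ∘ cover) sameSub-true
  where
  sameSub-true : ∀ {c c'} → index (cover c) ≡ index (cover c') → sameSub f V c c' ≡ true
  sameSub-true {c} {c'} eq = Equivalence.to T-≡ (all⁻ _ (All.universal agree (allVecs n)))
    where
    agree : ∀ a → T ⌊ subfun f V c a ≟B subfun f V c' a ⌋
    agree a = fromWitness (begin
      subfun f V c a                       ≡⟨ lookup-index (cover c) a ⟩
      List.lookup W (index (cover c)) a    ≡⟨ cong (λ i → List.lookup W i a) eq ⟩
      List.lookup W (index (cover c')) a   ≡⟨ lookup-index (cover c') a ⟨
      subfun f V c' a                      ∎)
      where open ≡-Reasoning

-- Functions depending on few variables

DependsOnlyOn : List (Fin n) → BoolFun n → Set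
DependsOnlyOn L F = ∀ x y → (∀ {i} → i ∈ L → lookup x i ≡ lookup y i) → F x ≡ F y

constants : List (BoolFun n)
constants = (λ _ → false) ∷ (λ _ → true) ∷ []

constants-complete : ∀ {F : BoolFun n} c → (∀ x → F x ≡ c) → Any (F ≗_) constants
constants-complete false F≡c = here F≡c
constants-complete true  F≡c = there (here F≡c)

functionsOn : List (Fin n) → List (BoolFun n)
functionsOn []      = constants
functionsOn (i ∷ L) =
  cartesianProductWith (λ F₀ F₁ x → if lookup x i then F₁ x else F₀ x) (functionsOn L) (functionsOn L)

length-functionsOn : ∀ (L : List (Fin n)) → length (functionsOn L) ≡ 2 ^ 2 ^ length L
length-functionsOn []      = refl
length-functionsOn (i ∷ L) = begin
  length (functionsOn (i ∷ L))
    ≡⟨ length-cartesianProductWith _ (functionsOn L) (functionsOn L) ⟩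
  length (functionsOn L) * length (functionsOn L) ≡⟨ cong (λ k → k * k) (length-functionsOn L) ⟩
  2 ^ 2 ^ length L * 2 ^ 2 ^ length L             ≡⟨ ^-distribˡ-+-* 2 (2 ^ length L) (2 ^ length L) ⟨
  2 ^ (2 ^ length L + 2 ^ length L)               ≡⟨ cong (λ k → 2 ^ (2 ^ length L + k)) (+-identityʳ _) ⟨
  2 ^ 2 ^ length (i ∷ L)                          ∎
  where open ≡-Reasoning

functionsOn-complete : ∀ L (F : BoolFun n) → DependsOnlyOn L F → Any (F ≗_) (functionsOn L)
functionsOn-complete {n} [] F dep = constants-complete _ (λ x → dep x (replicate n false) λ ())
functionsOn-complete (i ∷ L) F dep =
  cartesianProductWith⁺ _ cases (functionsOn-complete L (F-at false) (F-at-dep false))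
                               (functionsOn-complete L (F-at true) (F-at-dep true))
  where
  F-at : Bool → BoolFun _
  F-at b x = F (x [ i ]≔ b)

  F-at-dep : ∀ b → DependsOnlyOn L (F-at b)
  F-at-dep b x y agree = dep _ _ agree-updated
    where
    agree-updated : ∀ {j} → j ∈ i ∷ L → lookup (x [ i ]≔ b) j ≡ lookup (y [ i ]≔ b) j
    agree-updated {j} j∈ with j ≟ᶠ i | j∈
    ... | yes refl | _       = trans (lookup∘update i x b) (sym (lookup∘update i y b))
    ... | no  j≢i  | here j≡i = ⊥-elim (j≢i j≡i)
    ... | no  j≢i  | there j∈L =
      trans (lookup∘update′ j≢i x b) (trans (agree j∈L) (sym (lookup∘update′ j≢i y b)))

  cases : ∀ {G₀ G₁} → F-at false ≗ G₀ → F-at true ≗ G₁ →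
    F ≗ (λ x → if lookup x i then G₁ x else G₀ x)
  cases {G₀} {G₁} F₀≗G₀ F₁≗G₁ x = trans (cong F (sym ([]≔-lookup x i))) (by-value (lookup x i))
    where
    by-value : ∀ b → F-at b x ≡ (if b then G₁ x else G₀ x)
    by-value false = F₀≗G₀ x
    by-value true  = F₁≗G₁ x

leavesIn : Subset m → Formula m → List (Fin m)
leavesIn U (const _)    = []
leavesIn U (lit _ j)    = if U j then j ∷ [] else []
leavesIn U (node _ φ ψ) = leavesIn U φ ++ leavesIn U ψ

leafCount : Subset m → Formula m → ℕ
leafCount U (const _)    = 0
leafCount U (lit _ j)    = if U j then 1 else 0
leafCount U (node _ φ ψ) = leafCount U φ + leafCount U ψ

length-leavesIn : ∀ (U : Subset m) φ → length (leavesIn U φ) ≡ leafCount U φ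
length-leavesIn U (const _)    = refl
length-leavesIn U (lit _ j) with U j
... | false = refl
... | true  = refl
length-leavesIn U (node _ φ ψ) =
  trans (length-++ (leavesIn U φ)) (cong₂ _+_ (length-leavesIn U φ) (length-leavesIn U ψ))

eval-lit-cong : ∀ s {i : Fin m} {j : Fin n} {x y} → lookup x i ≡ lookup y j →
  eval (lit s i) x ≡ eval (lit s j) y
eval-lit-cong true  xᵢ≡yⱼ = xᵢ≡yⱼ
eval-lit-cong false xᵢ≡yⱼ = cong not xᵢ≡yⱼ

lookup-merge : ∀ (U : Subset m) x d j → lookup (merge U x d) j ≡ (if U j then lookup x j else lookup d j)
lookup-merge U x d j = lookup∘tabulate _ j

lookup-merge-at : ∀ (U : Subset m) x d {j b} → U j ≡ b →
  lookup (merge U x d) j ≡ (if b then lookup x j else lookup d j)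
lookup-merge-at U x d {j} refl = lookup-merge U x d j

subfun-dependsOnlyOn-leavesIn : ∀ (U : Subset m) φ d → DependsOnlyOn (leavesIn U φ) (subfun (eval φ) U d)
subfun-dependsOnlyOn-leavesIn U (const _) d x y agree = refl
subfun-dependsOnlyOn-leavesIn U (lit s j) d x y agree = eval-lit-cong s (begin
  lookup (merge U x d) j                   ≡⟨ lookup-merge U x d j ⟩
  (if U j then lookup x j else lookup d j) ≡⟨ inside (U j) agree ⟩
  (if U j then lookup y j else lookup d j) ≡⟨ lookup-merge U y d j ⟨
  lookup (merge U y d) j                   ∎)
  where
  open ≡-Reasoning
  inside : ∀ b → (∀ {i} → i ∈ (if b then j ∷ [] else []) → lookup x i ≡ lookup y i) →
    (if b then lookup x j else lookup d j) ≡ (if b then lookup y j else lookup d j)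
  inside false _     = refl
  inside true  agree = agree (here refl)
subfun-dependsOnlyOn-leavesIn U (node g φ ψ) d x y agree = cong₂ g
  (subfun-dependsOnlyOn-leavesIn U φ d x y (agree ∘ ∈-++⁺ˡ))
  (subfun-dependsOnlyOn-leavesIn U ψ d x y (agree ∘ ∈-++⁺ʳ (leavesIn U φ)))

-- Nečiporuk's family of restrictions

pointwise : (Bool → Bool → Bool) → BoolFun m → BoolFun m → BoolFun m
pointwise g F G x = g (F x) (G x)

unaries : List (Bool → Bool)
unaries = id ∷ not ∷ (λ _ → false) ∷ (λ _ → true) ∷ []

unaries-complete : ∀ u → Any (u ≗_) unaries
unaries-complete u with u false in u₀ | u true in u₁
... | false | true  = here λ { false → u₀ ; true → u₁ }
... | true  | false = there (here λ { false → u₀ ; true → u₁ })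
... | false | false = there (there (here λ { false → u₀ ; true → u₁ }))
... | true  | true  = there (there (there (here λ { false → u₀ ; true → u₁ })))

withUnaries : List (BoolFun m) → List (BoolFun m)
withUnaries = cartesianProductWith _∘′_ unaries

length-withUnaries : ∀ (C : List (BoolFun m)) → length (withUnaries C) ≡ 4 * length C
length-withUnaries = length-cartesianProductWith _∘′_ unaries

withUnaries-complete : ∀ {F : BoolFun m} {u C} → Any (λ G → F ≗ u ∘′ G) C → Any (F ≗_) (withUnaries C)
withUnaries-complete {u = u} = cartesianProductWith⁺ _∘′_
  (λ {u'} {G} u≗u' F≗uG x → trans (F≗uG x) (u≗u' (G x))) (unaries-complete u)

-- A restriction with s free leaves is constant if s = 0 and otherwise a unary function of a
-- member of C. Folding constant subformulas into that unary function is what bounds the family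
-- by 16^s, independently of the leaves outside U.
Represented : ℕ → BoolFun m → List (BoolFun m) → Set
Represented zero    F C = Σ Bool λ c → ∀ x → F x ≡ c
Represented (suc _) F C = ∃[ u ] Any (λ G → F ≗ u ∘′ G) C

familyFrom : ℕ → List (BoolFun m) → List (BoolFun m)
familyFrom zero    _ = constants
familyFrom (suc _) C = withUnaries C

familyFrom-complete : ∀ s {F : BoolFun m} {C} → Represented s F C → Any (F ≗_) (familyFrom s C)
familyFrom-complete zero    (c , F≡c) = constants-complete c F≡c
familyFrom-complete (suc _) (u , F∈C) = withUnaries-complete {u = u} F∈C

length-familyFrom : ∀ s (C : List (BoolFun m)) → 1 ≤ s → 16 * length C ≤ 16 ^ s →
  length (familyFrom s C) ≤ 16 ^ s
length-familyFrom (suc s) C _ bound = begin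
  length (withUnaries C) ≡⟨ length-withUnaries C ⟩
  4 * length C           ≤⟨ *-monoˡ-≤ (length C) (m≤m+n 4 12) ⟩
  16 * length C          ≤⟨ bound ⟩
  16 ^ suc s             ∎
  where open ≤-Reasoning

coreNode : (Bool → Bool → Bool) → ℕ → ℕ → List (BoolFun m) → List (BoolFun m) → List (BoolFun m)
coreNode g zero    _       _  C₂ = C₂
coreNode g (suc _) zero    C₁ _  = C₁
coreNode g (suc _) (suc _) C₁ C₂ = cartesianProductWith (pointwise g) (withUnaries C₁) (withUnaries C₂)

coreNode-represented : ∀ g s t {F₁ F₂ : BoolFun m} {C₁ C₂} →
  Represented s F₁ C₁ → Represented t F₂ C₂ →
  Represented (s + t) (pointwise g F₁ F₂) (coreNode g s t C₁ C₂)
coreNode-represented g zero    zero    (c₁ , F₁≡c₁) (c₂ , F₂≡c₂) =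
  g c₁ c₂ , λ x → cong₂ g (F₁≡c₁ x) (F₂≡c₂ x)
coreNode-represented g zero    (suc _) (c₁ , F₁≡c₁) (u₂ , F₂∈C₂) =
  (λ b → g c₁ (u₂ b)) , Any.map (λ F₂≗u₂G x → cong₂ g (F₁≡c₁ x) (F₂≗u₂G x)) F₂∈C₂
coreNode-represented g (suc _) zero    (u₁ , F₁∈C₁) (c₂ , F₂≡c₂) =
  (λ b → g (u₁ b) c₂) , Any.map (λ F₁≗u₁G x → cong₂ g (F₁≗u₁G x) (F₂≡c₂ x)) F₁∈C₁
coreNode-represented g (suc _) (suc _) (u₁ , F₁∈C₁) (u₂ , F₂∈C₂) =
  id , cartesianProductWith⁺ (pointwise g)
         (λ F₁≗G₁ F₂≗G₂ x → cong₂ g (F₁≗G₁ x) (F₂≗G₂ x))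
         (withUnaries-complete {u = u₁} F₁∈C₁) (withUnaries-complete {u = u₂} F₂∈C₂)

coreNode-length : ∀ g s t (C₁ C₂ : List (BoolFun m)) → 1 ≤ s + t →
  (1 ≤ s → 16 * length C₁ ≤ 16 ^ s) → (1 ≤ t → 16 * length C₂ ≤ 16 ^ t) →
  16 * length (coreNode g s t C₁ C₂) ≤ 16 ^ (s + t)
coreNode-length g zero    t       C₁ C₂ h _  bound₂ = bound₂ h
coreNode-length g (suc s) zero    C₁ C₂ h bound₁ _ =
  subst (λ k → 16 * length C₁ ≤ 16 ^ k) (sym (+-identityʳ (suc s))) (bound₁ (s≤s z≤n))
coreNode-length g (suc s) (suc t) C₁ C₂ h bound₁ bound₂ = begin
  16 * length (cartesianProductWith (pointwise g) (withUnaries C₁) (withUnaries C₂))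
    ≡⟨ cong (16 *_) (length-cartesianProductWith (pointwise g) (withUnaries C₁) (withUnaries C₂)) ⟩
  16 * (length (withUnaries C₁) * length (withUnaries C₂))
    ≡⟨ cong₂ (λ a b → 16 * (a * b)) (length-withUnaries C₁) (length-withUnaries C₂) ⟩
  16 * ((4 * length C₁) * (4 * length C₂))
    ≡⟨ regroup (length C₁) (length C₂) ⟩
  (16 * length C₁) * (16 * length C₂)
    ≤⟨ *-mono-≤ (bound₁ (s≤s z≤n)) (bound₂ (s≤s z≤n)) ⟩
  16 ^ suc s * 16 ^ suc t
    ≡⟨ ^-distribˡ-+-* 16 (suc s) (suc t) ⟨
  16 ^ (suc s + suc t) ∎
  where
  open ≤-Reasoning
  regroup : ∀ a b → 16 * ((4 * a) * (4 * b)) ≡ (16 * a) * (16 * b)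
  regroup = solve-∀

module _ (U : Subset m) where

  core : Formula m → List (BoolFun m)
  core (const _)    = []
  core (lit s j)    = eval (lit s j) ∷ []
  core (node g φ ψ) = coreNode g (leafCount U φ) (leafCount U ψ) (core φ) (core ψ)

  family : Formula m → List (BoolFun m)
  family φ = familyFrom (leafCount U φ) (core φ)

  core-represented : ∀ φ d → Represented (leafCount U φ) (subfun (eval φ) U d) (core φ)
  core-represented (const c)    d = c , λ _ → refl
  core-represented (lit s j)    d with U j in Uj
  ... | false = eval (lit s j) d , λ x → eval-lit-cong s (lookup-merge-at U x d Uj)
  ... | true  = id , here λ x → eval-lit-cong s (lookup-merge-at U x d Uj)
  core-represented (node g φ ψ) d =
    coreNode-represented g (leafCount U φ) (leafCount U ψ) (core-represented φ d) (core-represented ψ d)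

  core-length : ∀ φ → 1 ≤ leafCount U φ → 16 * length (core φ) ≤ 16 ^ leafCount U φ
  core-length (lit s j) h with U j
  ... | true = ≤-refl
  core-length (node g φ ψ) h =
    coreNode-length g (leafCount U φ) (leafCount U ψ) (core φ) (core ψ) h (core-length φ) (core-length ψ)

  family-complete : ∀ φ d → Any (subfun (eval φ) U d ≗_) (family φ)
  family-complete φ d = familyFrom-complete (leafCount U φ) (core-represented φ d)

  family-length : ∀ φ → 1 ≤ leafCount U φ → length (family φ) ≤ 16 ^ leafCount U φ
  family-length φ h = length-familyFrom (leafCount U φ) (core φ) h (core-length φ h)

disjunctions : List (List (BoolFun n)) → List (BoolFun n)
disjunctions []       = (λ _ → false) ∷ []
disjunctions (W ∷ Ws) = cartesianProductWith (pointwise _∨_) W (disjunctions Ws)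

disjunctions-complete : ∀ {F : A → BoolFun n} {W : A → List (BoolFun n)} → (∀ a → Any (F a ≗_) (W a)) →
  ∀ as → Any ((λ x → or (map (λ a → F a x) as)) ≗_) (disjunctions (map W as))
disjunctions-complete F∈W []       = here λ _ → refl
disjunctions-complete F∈W (a ∷ as) = cartesianProductWith⁺ (pointwise _∨_)
  (λ F≗G Fs≗H x → cong₂ _∨_ (F≗G x) (Fs≗H x)) (F∈W a) (disjunctions-complete F∈W as)

length-disjunctions : ∀ {W : A → List (BoolFun n)} {k} as → All (λ a → length (W a) ≤ k) as →
  length (disjunctions (map W as)) ≤ k ^ length as
length-disjunctions []             []       = ≤-refl
length-disjunctions {W = W} {k} (a ∷ as) (Wa≤k ∷ Was≤k) = begin
  length (cartesianProductWith (pointwise _∨_) (W a) (disjunctions (map W as)))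
    ≡⟨ length-cartesianProductWith (pointwise _∨_) (W a) (disjunctions (map W as)) ⟩
  length (W a) * length (disjunctions (map W as))
    ≤⟨ *-mono-≤ Wa≤k (length-disjunctions as Was≤k) ⟩
  k * k ^ length as ∎
  where open ≤-Reasoning

or-dependsOnlyOn : ∀ {L : List (Fin n)} {F : A → BoolFun n} as → All (λ a → DependsOnlyOn L (F a)) as →
  DependsOnlyOn L (λ x → or (map (λ a → F a x) as))
or-dependsOnlyOn []       []           x y agree = refl
or-dependsOnlyOn (a ∷ as) (Fa ∷ Fas) x y agree =
  cong₂ _∨_ (Fa x y agree) (or-dependsOnlyOn as Fas x y agree)

-- Fixing the nondeterministic variables

fixSuffix : Vec Bool m → Formula (n + m) → Formula n
fixSuffix           b (const c)    = const c
fixSuffix {n = n}   b (lit s j)    = [ lit s , (λ k → const (eval (lit s k) b)) ]′ (splitAt n j)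
fixSuffix           b (node g φ ψ) = node g (fixSuffix b φ) (fixSuffix b ψ)

eval-fixSuffix : ∀ (b : Vec Bool m) φ (a : Vec Bool n) → eval (fixSuffix b φ) a ≡ eval φ (a ++ᵛ b)
eval-fixSuffix b (const c)    a = refl
eval-fixSuffix {n = n} b (lit s j) a with splitAt n j | lookup-splitAt n a b j
... | inj₁ _ | aᵢ≡ = eval-lit-cong s (sym aᵢ≡)
... | inj₂ _ | bₖ≡ = eval-lit-cong s (sym bₖ≡)
eval-fixSuffix b (node g φ ψ) a = cong₂ g (eval-fixSuffix b φ a) (eval-fixSuffix b ψ a)

leavesIn-fixSuffix : ∀ (V : Subset n) (b b' : Vec Bool m) φ →
  leavesIn V (fixSuffix b φ) ≡ leavesIn V (fixSuffix b' φ)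
leavesIn-fixSuffix V b b' (const _) = refl
leavesIn-fixSuffix {n = n} V b b' (lit s j) with splitAt n j
... | inj₁ _ = refl
... | inj₂ _ = refl
leavesIn-fixSuffix V b b' (node _ φ ψ) =
  cong₂ _++_ (leavesIn-fixSuffix V b b' φ) (leavesIn-fixSuffix V b b' ψ)

size-fixSuffix : ∀ (b : Vec Bool m) (φ : Formula (n + m)) → size (fixSuffix b φ) ≤ size φ
size-fixSuffix b (const _) = z≤n
size-fixSuffix {n = n} b (lit s j) with splitAt n j
... | inj₁ _ = ≤-refl
... | inj₂ _ = z≤n
size-fixSuffix b (node _ φ ψ) = +-mono-≤ (size-fixSuffix b φ) (size-fixSuffix b ψ)

ceilDiv-≤ : ∀ {x k s} → 1 ≤ k → x ≤ k * s → ceilDiv x k ≤ s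
ceilDiv-≤ {x} {suc d} {s} _ x≤ks = <⇒≤pred (m<n*o⇒m/o<n {x + d} {suc s} {suc d} (begin-strict
  x + d             ≤⟨ +-monoˡ-≤ d x≤ks ⟩
  suc d * s + d     <⟨ +-monoʳ-< (suc d * s) (n<1+n d) ⟩
  suc d * s + suc d ≡⟨ rearrange d s ⟩
  suc s * suc d     ∎))
  where
  open ≤-Reasoning
  rearrange : ∀ d s → suc d * s + suc d ≡ suc s * suc d
  rearrange = solve-∀

ceilDiv-mono : ∀ k {x y} → x ≤ y → ceilDiv x k ≤ ceilDiv y k
ceilDiv-mono zero    _   = z≤n
ceilDiv-mono (suc d) x≤y = /-monoˡ-≤ (suc d) (+-monoˡ-≤ d x≤y)

b-LNBF-nondecreasing : ∀ δ → NonDecreasing (b-LNBF δ)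
b-LNBF-nondecreasing δ m m' _ m≤m' with m <? 4 | m' <? 4
... | yes _   | _        = z≤n
... | no m≮4  | yes m'<4 = ⊥-elim (m≮4 (≤-<-trans m≤m' m'<4))
... | no _    | no _     = ⊔-mono-≤ (ceilDiv-mono (4 * 2 ^ δ) (⌈log₂⌉-mono-≤ m≤m'))
                                    (ceilDiv-mono 4 (⌈log₂⌉-mono-≤ (⌈log₂⌉-mono-≤ m≤m')))

b-LNBF-≤ : ∀ δ {r s} → r ≤ 2 ^ 2 ^ s → (1 ≤ s → r ≤ (16 ^ s) ^ 2 ^ δ) → b-LNBF δ r ≤ s
b-LNBF-≤ δ {r} _ _ with r <? 4
... | yes _ = z≤n
b-LNBF-≤ δ {r} {zero}  r≤2 _ | no r≮4 = ⊥-elim (r≮4 (s≤s (≤-trans r≤2 (n≤1+n 2))))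
b-LNBF-≤ δ {r} {suc s} r≤2^2^s r≤16^s | no _ = ⊔-lub
  (ceilDiv-≤ (≤-trans (m^n>0 2 δ) (m≤n*m (2 ^ δ) 4)) (begin
    ⌈log₂ r ⌉                         ≤⟨ ⌈log₂⌉-mono-≤ (r≤16^s (s≤s z≤n)) ⟩
    ⌈log₂ (16 ^ suc s) ^ 2 ^ δ ⌉      ≡⟨ cong ⌈log₂_⌉ (power-of-two (suc s)) ⟩
    ⌈log₂ 2 ^ (4 * 2 ^ δ * suc s) ⌉   ≡⟨ ⌈log₂2^n⌉≡n (4 * 2 ^ δ * suc s) ⟩
    4 * 2 ^ δ * suc s                 ∎))
  (ceilDiv-≤ (s≤s z≤n) (begin
    ⌈log₂ ⌈log₂ r ⌉ ⌉                 ≤⟨ ⌈log₂⌉-mono-≤ (⌈log₂⌉-mono-≤ r≤2^2^s) ⟩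
    ⌈log₂ ⌈log₂ 2 ^ 2 ^ suc s ⌉ ⌉     ≡⟨ cong ⌈log₂_⌉ (⌈log₂2^n⌉≡n (2 ^ suc s)) ⟩
    ⌈log₂ 2 ^ suc s ⌉                 ≡⟨ ⌈log₂2^n⌉≡n (suc s) ⟩
    suc s                             ≤⟨ m≤n*m (suc s) 4 ⟩
    4 * suc s                         ∎))
  where
  open ≤-Reasoning
  power-of-two : ∀ t → (16 ^ t) ^ 2 ^ δ ≡ 2 ^ (4 * 2 ^ δ * t)
  power-of-two t = begin-equality
    (16 ^ t) ^ 2 ^ δ       ≡⟨ cong (_^ 2 ^ δ) (^-*-assoc 2 4 t) ⟩
    (2 ^ (4 * t)) ^ 2 ^ δ  ≡⟨ ^-*-assoc 2 (4 * t) (2 ^ δ) ⟩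
    2 ^ (4 * t * 2 ^ δ)    ≡⟨ cong (2 ^_) (swap t (2 ^ δ)) ⟩
    2 ^ (4 * 2 ^ δ * t)    ∎
    where
    swap : ∀ t e → 4 * t * e ≡ 4 * e * t
    swap = solve-∀

module _ {A : Set} (f : BoolFun n) (V : Subset n) (ψ : A → Formula n) (as : List A) (L : List (Fin n))
         (f≡or : ∀ x → f x ≡ or (map (λ a → eval (ψ a) x) as))
         (leaves≡L : All (λ a → leavesIn V (ψ a) ≡ L) as) where

  private
    or-restrictions : Vec Bool n → BoolFun n
    or-restrictions c x = or (map (λ a → subfun (eval (ψ a)) V c x) as)

    covers : ∀ {W} → (∀ c → Any (or-restrictions c ≗_) W) → Covers f V W
    covers cover c = Any.map (λ ≗G x → trans (f≡or (merge V x c)) (≗G x)) (cover c)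

  r≤2^2^length : r f V ≤ 2 ^ 2 ^ length L
  r≤2^2^length = ≤-trans (r≤length f V (covers λ c → functionsOn-complete L _ (dependsOnly c)))
                         (≤-reflexive (length-functionsOn L))
    where
    dependsOnly : ∀ c → DependsOnlyOn L (or-restrictions c)
    dependsOnly c = or-dependsOnlyOn as (All.map (λ {a} leaves≡ →
      subst (λ L' → DependsOnlyOn L' _) leaves≡ (subfun-dependsOnlyOn-leavesIn V (ψ a) c)) leaves≡L)

  r≤16^length : 1 ≤ length L → r f V ≤ (16 ^ length L) ^ length as
  r≤16^length 1≤∣L∣ =
    ≤-trans (r≤length f V (covers λ c → disjunctions-complete (λ a → family-complete V (ψ a) c) as))
            (length-disjunctions as (All.map familyBound leaves≡L))
    where
    familyBound : ∀ {a} → leavesIn V (ψ a) ≡ L → length (family V (ψ a)) ≤ 16 ^ length L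
    familyBound {a} leaves≡ = subst (λ s → length (family V (ψ a)) ≤ 16 ^ s) count≡
      (family-length V (ψ a) (subst (1 ≤_) (sym count≡) 1≤∣L∣))
      where
      count≡ : leafCount V (ψ a) ≡ length L
      count≡ = trans (sym (length-leavesIn V (ψ a))) (cong length leaves≡)

  b-LNBF-block : ∀ δ → length as ≡ 2 ^ δ → b-LNBF δ (r f V) ≤ length L
  b-LNBF-block δ ∣as∣≡ =
    b-LNBF-≤ δ r≤2^2^length λ 1≤∣L∣ →
      subst (λ k → r f V ≤ (16 ^ length L) ^ k) ∣as∣≡ (r≤16^length 1≤∣L∣)

sum-map-zero : ∀ (xs : List A) → sum (map (λ _ → 0) xs) ≡ 0
sum-map-zero []       = refl
sum-map-zero (_ ∷ xs) = sum-map-zero xs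

map-allFin-suc : ∀ {p} (g : Fin (suc p) → A) → map g (allFin (suc p)) ≡ g zero ∷ map (g ∘ suc) (allFin p)
map-allFin-suc {p = p} g =
  cong (g zero ∷_) (trans (cong (map g) (sym (map-tabulate id suc))) (sym (map-∘ (allFin p))))

indicator : ∀ {p} → Fin p → Fin p → ℕ
indicator k i = if ⌊ k ≟ᶠ i ⌋ then 1 else 0

indicator-suc : ∀ {p} (k i : Fin p) → indicator (suc k) (suc i) ≡ indicator k i
indicator-suc k i with k ≟ᶠ i
... | yes _ = refl
... | no  _ = refl

sum-indicator≤1 : ∀ {p} (k : Fin p) → sum (map (indicator k) (allFin p)) ≤ 1
sum-indicator≤1 {suc p} zero = begin
  sum (map (indicator zero) (allFin (suc p))) ≡⟨ cong sum (map-allFin-suc {p = p} (indicator zero)) ⟩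
  1 + sum (map (λ _ → 0) (allFin p))          ≡⟨ cong suc (sum-map-zero (allFin p)) ⟩
  1                                           ∎
  where open ≤-Reasoning
sum-indicator≤1 {suc p} (suc k) = begin
  sum (map (indicator (suc k)) (allFin (suc p)))  ≡⟨ cong sum (map-allFin-suc {p = p} (indicator (suc k))) ⟩
  sum (map (indicator (suc k) ∘ suc) (allFin p))  ≡⟨ cong sum (map-cong (indicator-suc k) (allFin p)) ⟩
  sum (map (indicator k) (allFin p))              ≤⟨ sum-indicator≤1 k ⟩
  1                                               ∎
  where open ≤-Reasoning

sum-leafCount-block≤size : ∀ {p} (π : Fin n → Fin p) φ →
  sum (map (λ i → leafCount (block π i) φ) (allFin p)) ≤ size φ
sum-leafCount-block≤size {p = p} π (const _)    = ≤-reflexive (sum-map-zero (allFin p))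
sum-leafCount-block≤size         π (lit _ j)    = sum-indicator≤1 (π j)
sum-leafCount-block≤size {p = p} π (node _ φ ψ) =
  ≤-trans (≤-reflexive (sum-map-+ (λ i → leafCount (block π i) φ) (λ i → leafCount (block π i) ψ)
                                  (allFin p)))
          (+-mono-≤ (sum-leafCount-block≤size π φ) (sum-leafCount-block≤size π ψ))

sum-b-LNBF≤size : ∀ {A : Set} δ (f : BoolFun n) (ψ₀ : Formula n) (ψ : A → Formula n) as
  {p} (π : Fin n → Fin p) →
  length as ≡ 2 ^ δ → (∀ x → f x ≡ or (map (λ a → eval (ψ a) x) as)) →
  (∀ V → All (λ a → leavesIn V (ψ a) ≡ leavesIn V ψ₀) as) →
  sum (map (λ i → b-LNBF δ (r f (block π i))) (allFin p)) ≤ size ψ₀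
sum-b-LNBF≤size δ f ψ₀ ψ as {p} π ∣as∣≡ f≡or sameLeaves = begin
  sum (map (λ i → b-LNBF δ (r f (block π i))) (allFin p)) ≤⟨ sum-map-mono blockBound (allFin p) ⟩
  sum (map (λ i → leafCount (block π i) ψ₀) (allFin p))   ≤⟨ sum-leafCount-block≤size π ψ₀ ⟩
  size ψ₀                                                  ∎
  where
  open ≤-Reasoning
  blockBound : ∀ i → b-LNBF δ (r f (block π i)) ≤ leafCount (block π i) ψ₀
  blockBound i = ≤-trans
    (b-LNBF-block f (block π i) ψ as (leavesIn (block π i) ψ₀) f≡or (sameLeaves (block π i)) δ ∣as∣≡)
    (≤-reflexive (length-leavesIn (block π i) ψ₀))

LNBF-neciporuk : ∀ δ n (f : BoolFun n) p (π : Fin n → Fin p) →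
  LNBF≥ δ f (sum (map (λ i → b-LNBF δ (r f (block π i))) (allFin p)))
LNBF-neciporuk δ n f p π φ computes = ≤-trans
  (sum-b-LNBF≤size δ f (fixSuffix (replicate δ false) φ) (λ b → fixSuffix b φ) (allVecs δ) π
     (length-allVecs δ) f≡or sameLeaves)
  (size-fixSuffix (replicate δ false) φ)
  where
  f≡or : ∀ x → f x ≡ or (map (λ b → eval (fixSuffix b φ) x) (allVecs δ))
  f≡or x = trans (computes x) (cong or (map-cong (λ b → sym (eval-fixSuffix b φ x)) (allVecs δ)))
  sameLeaves : ∀ V →
    All (λ b → leavesIn V (fixSuffix b φ) ≡ leavesIn V (fixSuffix (replicate δ false) φ)) (allVecs δ)
  sameLeaves V = All.universal (λ b → leavesIn-fixSuffix V b _ φ) (allVecs δ)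

BF-neciporuk : ∀ n (f : BoolFun n) p (π : Fin n → Fin p) →
  BF≥ f (sum (map (λ i → b-BF (r f (block π i))) (allFin p)))
BF-neciporuk n f p π φ computes =
  sum-b-LNBF≤size 0 f φ (λ _ → φ) (tt ∷ []) π refl
    (λ x → trans (computes x) (sym (∨-identityʳ _))) (λ V → refl ∷ [])

proposition8p1 : ((δ : ℕ) → IsNeciporuk (LNBF≥ δ) (b-LNBF δ)) × IsNeciporuk BF≥ b-BF
proposition8p1 = (λ δ → b-LNBF-nondecreasing δ , LNBF-neciporuk δ) , (b-LNBF-nondecreasing 0 , BF-neciporuk)
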